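{- The upset of $\mathsf{Log}$ generated by the set $\{ [\vdash_{\mathsf{V}_{\kappa}}] \colon \kappa \text{ is an infinite cardinal}\}$ is $\mathsf{Log}$.
   Context: A logic $\vdash$ is a substitution-invariant consequence relation on the set of formulas, in some infinite cardinal of variables, of a language without constants. $\mathrm{Mod}^{\equiv}(\vdash)$ is the class of matrices $\langle \mathbf{A},F\rangle$ with $F$ a deductive filter of $\vdash$ on $\mathbf{A}$ and trivial Suszko congruence. An interpretation of $\vdash$ into $\vdash'$ is a translation $\tau$ of languages with $\langle \mathbf{A}^\tau,F\rangle\in\mathrm{Mod}^{\equiv}(\vdash)$ for all $\langle \mathbf{A},F\rangle\in\mathrm{Mod}^{\equiv}(\vdash')$; $[\vdash]$ is the class of logics equi-interpretable with $\vdash$ and $\mathsf{Log}$ the poset of these classes ordered by interpretability. The basic logic $\vdash_{\mathsf{V}}$ of a variety $\mathsf{V}$ is the logic in the language of $\mathsf{V}$, in countably many variables, induced by all matrices $\langle \mathbf{A},F\rangle$ with $\mathbf{A}\in\mathsf{V}$ and $F\subseteq A$. For an infinite cardinal $\kappa$, $\mathscr{L}_\kappa$ is the language with $\kappa$ distinct $n$-ary symbols for every $n$, and $\mathsf{V}_\kappa$ is the variety of all $\mathscr{L}_\kappa$-algebras. (For each $\kappa$, $[\vdash_{\mathsf{V}_\kappa}]$ is the minimum of the subposet of classes of logics with language of size at most $\kappa$.) -}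

module Defs where

open import Level using (0ℓ)
open import Data.Nat using (ℕ; suc)
open import Data.Fin using (Fin)
open import Data.Product using (Σ; ∃; _×_; _,_)
open import Relation.Binary.PropositionalEquality using (_≡_; _≢_)
open import Relation.Unary using (Pred; _∈_; _⊆_)
open import Function.Definitions using (Injective)

record Language : Set₁ where
  field
    Sym : Set
    ar  : Sym → ℕ
open Language public

NoConstants : Language → Set
NoConstants L = ∀ (f : Sym L) → ar L f ≢ 0

-- formulas (terms) of L over a set X of variables
data Term (L : Language) (X : Set) : Set where
  var : X → Term L X
  app : (f : Sym L) → (Fin (ar L f) → Term L X) → Term L X

Infinite : Set → Set
Infinite X = Σ (ℕ → X) λ e → Injective _≡_ _≡_ e

record Algebra (L : Language) : Set₁ where
  field
    Carrier : Set
    op      : (f : Sym L) → (Fin (ar L f) → Carrier) → Carrier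
open Algebra public

eval : ∀ {L X} (A : Algebra L) → (X → Carrier A) → Term L X → Carrier A
eval A v (var x)    = v x
eval A v (app f ts) = op A f (λ i → eval A v (ts i))

subst : ∀ {L X Y} → (X → Term L Y) → Term L X → Term L Y
subst σ (var x)    = σ x
subst σ (app f ts) = app f (λ i → subst σ (ts i))

record IsCongruence {L} (A : Algebra L) (θ : Carrier A → Carrier A → Set) : Set where
  field
    θ-refl  : ∀ a → θ a a
    θ-sym   : ∀ {a b} → θ a b → θ b a
    θ-trans : ∀ {a b c} → θ a b → θ b c → θ a c
    θ-comp  : ∀ (f : Sym L) (as bs : Fin (ar L f) → Carrier A) →
              (∀ i → θ (as i) (bs i)) → θ (op A f as) (op A f bs)

Compatible : ∀ {L} (A : Algebra L) → (Carrier A → Carrier A → Set) → Pred (Carrier A) 0ℓ → Set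
Compatible A θ F = ∀ {a b} → θ a b → a ∈ F → b ∈ F

-- Leibniz congruence Ω^A F: the largest congruence of A compatible with F.
-- (a,b) is in it iff some congruence compatible with F relates a and b.
Leibniz : ∀ {L} (A : Algebra L) → Pred (Carrier A) 0ℓ → Carrier A → Carrier A → Set₁
Leibniz A F a b = Σ (Carrier A → Carrier A → Set) λ θ →
  IsCongruence A θ × Compatible A θ F × θ a b

record PreLogic : Set₂ where
  field
    Lang : Language
    Var  : Set
    _⊢_  : Pred (Term Lang Var) 0ℓ → Term Lang Var → Set₁
open PreLogic public

_[_] : ∀ {L X} → (X → Term L X) → Pred (Term L X) 0ℓ → Pred (Term L X) 0ℓ
(σ [ Γ ]) ψ = Σ _ λ χ → χ ∈ Γ × (ψ ≡ subst σ χ)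

record IsLogic (P : PreLogic) : Set₁ where
  private
    L = Lang P
    V = Var P
    _⊩_ = _⊢_ P
  field
    noConst : NoConstants L
    varInf  : Infinite V
    reflex  : ∀ {Γ φ} → φ ∈ Γ → Γ ⊩ φ
    mono    : ∀ {Γ Δ φ} → Γ ⊆ Δ → Γ ⊩ φ → Δ ⊩ φ
    cut     : ∀ {Γ Δ φ} → (∀ {ψ} → ψ ∈ Δ → Γ ⊩ ψ) → Δ ⊩ φ → Γ ⊩ φ
    struct  : ∀ {Γ φ} (σ : V → Term L V) → Γ ⊩ φ → (σ [ Γ ]) ⊩ subst σ φ

Logic : Set₂
Logic = Σ PreLogic IsLogic

IsFilter : (P : PreLogic) (A : Algebra (Lang P)) → Pred (Carrier A) 0ℓ → Set₁
IsFilter P A F = ∀ Γ φ → _⊢_ P Γ φ → (v : Var P → Carrier A) →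
  (∀ {γ} → γ ∈ Γ → eval A v γ ∈ F) → eval A v φ ∈ F

Suszko : (P : PreLogic) (A : Algebra (Lang P)) → Pred (Carrier A) 0ℓ →
         Carrier A → Carrier A → Set₁
Suszko P A F a b = ∀ (G : Pred (Carrier A) 0ℓ) → IsFilter P A G → F ⊆ G → Leibniz A G a b

InModSuszko : (P : PreLogic) (A : Algebra (Lang P)) → Pred (Carrier A) 0ℓ → Set₁
InModSuszko P A F = IsFilter P A F × (∀ a b → Suszko P A F a b → a ≡ b)

Translation : Language → Language → Set
Translation L L' = (f : Sym L) → Term L' (Fin (ar L f))

_^_ : ∀ {L L'} → Algebra L' → Translation L L' → Algebra L
Carrier (A ^ τ) = Carrier A
op (A ^ τ) f as = eval A as (τ f)

-- ⊢ is interpretable into ⊢'  (i.e. [⊢] ≤ [⊢'] in Log)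
Interpretable : PreLogic → PreLogic → Set₁
Interpretable P P' = Σ (Translation (Lang P) (Lang P')) λ τ →
  ∀ (A : Algebra (Lang P')) (F : Pred (Carrier A) 0ℓ) →
  InModSuszko P' A F → InModSuszko P (A ^ τ) F

-- κ distinct n-ary symbols for every n ≥ 1 (no constants)
Lκ : Set → Language
Sym (Lκ K) = ℕ × K
ar  (Lκ K) (n , _) = suc n

-- basic logic of the variety V_κ of all Lκ-algebras: induced by all
-- matrices ⟨A, F⟩ with A any Lκ-algebra and F ⊆ A; countably many variables
BasicVκ : Set → PreLogic
Lang (BasicVκ K) = Lκ K
Var  (BasicVκ K) = ℕ
_⊢_  (BasicVκ K) Γ φ = ∀ (A : Algebra (Lκ K)) (F : Pred (Carrier A) 0ℓ) (v : ℕ → Carrier A) →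
  (∀ {γ} → γ ∈ Γ → eval A v γ ∈ F) → eval A v φ ∈ F

module Submission where

-- Every logic ⊢ interprets some basic logic ⊢_{V_κ}, so the classes [⊢_{V_κ}]
-- generate all of Log as an upset.
--
-- Let L' be the language of ⊢ and K = ℕ ⊎ Sym L' (an infinite set).  The
-- translation τ : L_K → L' sends the symbol (n , f), for f of arity n + 1, to
-- f itself and every other symbol to a projection; this needs that L' has no
-- constants.  Hence every basic operation of an L'-algebra A is a term
-- operation of its reduct A^τ, so every congruence of A^τ is one of A and the
-- Leibniz congruences of A^τ are contained in those of A.  Moreover every
-- subset of every algebra is a deductive filter of the basic logic ⊢_{V_K}.
-- Together these give: if ⟨A , F⟩ has trivial Suszko congruence for ⊢, then
-- ⟨A^τ , F⟩ has trivial Suszko congruence for ⊢_{V_K}.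

open import Defs
open import Level using (0ℓ)
open import Data.Product using (Σ; _×_; _,_; proj₁)
open import Data.Sum using (_⊎_; inj₁; inj₂)
open import Data.Sum.Properties using (inj₁-injective)
open import Data.Nat using (ℕ; zero; suc; _≟_; pred)
open import Data.Nat.Properties using (≡-irrelevant)
open import Data.Fin using (Fin; zero)
open import Relation.Unary using (Pred)
open import Relation.Nullary using (yes; no; contradiction)
open import Relation.Binary.PropositionalEquality as Eq
  using (_≡_; _≢_; refl; sym; cong; subst₂)
open Eq.≡-Reasoning

congruence-respects-terms : ∀ {L X} (A : Algebra L) {θ : Carrier A → Carrier A → Set} →
  IsCongruence A θ → (t : Term L X) (v w : X → Carrier A) →
  (∀ x → θ (v x) (w x)) → θ (eval A v t) (eval A w t)
congruence-respects-terms A θ-cong (var x)    v w vθw = vθw x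
congruence-respects-terms A θ-cong (app f ts) v w vθw =
  IsCongruence.θ-comp θ-cong f _ _ λ i → congruence-respects-terms A θ-cong (ts i) v w vθw

RecoversOperations : ∀ {L L'} → Translation L L' → Set₁
RecoversOperations {L} {L'} τ = ∀ (f : Sym L') →
  Σ (Term L (Fin (ar L' f))) λ t →
    ∀ (A : Algebra L') (as : Fin (ar L' f) → Carrier A) → eval (A ^ τ) as t ≡ op A f as

reduct-congruence : ∀ {L L'} (τ : Translation L L') → RecoversOperations τ →
  (A : Algebra L') {θ : Carrier A → Carrier A → Set} →
  IsCongruence (A ^ τ) θ → IsCongruence A θ
reduct-congruence τ recovers A {θ} θ-cong = record
  { θ-refl  = θ-refl
  ; θ-sym   = θ-sym
  ; θ-trans = θ-trans
  ; θ-comp  = λ f as bs asθbs →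
      let (t , t-is-f) = recovers f
      in subst₂ θ (t-is-f A as) (t-is-f A bs)
           (congruence-respects-terms (A ^ τ) θ-cong t as bs asθbs)
  }
  where open IsCongruence θ-cong

reduct-Leibniz : ∀ {L L'} (τ : Translation L L') → RecoversOperations τ →
  (A : Algebra L') (G : Pred (Carrier A) 0ℓ) {a b : Carrier A} →
  Leibniz (A ^ τ) G a b → Leibniz A G a b
reduct-Leibniz τ recovers A G (θ , θ-cong , θ-compat , aθb) =
  θ , reduct-congruence τ recovers A θ-cong , θ-compat , aθb

-- The Suszko congruence can only shrink, since every ⊢'-filter G ⊇ F is a
-- ⊢-filter on A^τ whose Leibniz congruence embeds into Ω^A G.
interpretable-by : (P P' : PreLogic) (τ : Translation (Lang P) (Lang P')) →
  RecoversOperations τ →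
  (∀ (A : Algebra (Lang P')) G → IsFilter P' A G → IsFilter P (A ^ τ) G) →
  Interpretable P P'
interpretable-by P P' τ recovers filters-transfer = τ , λ A F (F-filter , suszko-trivial) →
  filters-transfer A F F-filter ,
  λ a b a~b → suszko-trivial a b λ G G-filter F⊆G →
    reduct-Leibniz τ recovers A G (a~b G (filters-transfer A G G-filter) F⊆G)

-- The basic logic of V_K holds in every matrix, so every subset of every
-- L_K-algebra is one of its deductive filters.
basic-filter : (K : Set) (A : Algebra (Lκ K)) (G : Pred (Carrier A) 0ℓ) → IsFilter (BasicVκ K) A G
basic-filter K A G Γ φ Γ⊢φ = Γ⊢φ A G

ℕ⊎-infinite : (X : Set) → Infinite (ℕ ⊎ X)
ℕ⊎-infinite X = inj₁ , inj₁-injective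

reindex-roundtrip : ∀ {C : Set} {m n} (o : (Fin m → C) → C) (e : m ≡ suc n) (as : Fin m → C) →
  o (λ j → as (Eq.subst Fin (sym e) (Eq.subst Fin e j))) ≡ o as
reindex-roundtrip o refl as = refl

arity-suc : ∀ {m} → m ≢ 0 → m ≡ suc (pred m)
arity-suc {zero}  m≢0 = contradiction refl m≢0
arity-suc {suc m} m≢0 = refl

module Covering (L' : Language) where

  K : Set
  K = ℕ ⊎ Sym L'

  τ : Translation (Lκ K) L'
  τ (n , inj₁ _) = var zero
  τ (n , inj₂ f) with ar L' f ≟ suc n
  ... | yes e = app f (λ i → var (Eq.subst Fin e i))
  ... | no _  = var zero

  τ-on-arity : ∀ n f (e : ar L' f ≡ suc n) → τ (n , inj₂ f) ≡ app f (λ i → var (Eq.subst Fin e i))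
  τ-on-arity n f e with ar L' f ≟ suc n
  ... | yes e′ rewrite ≡-irrelevant e e′ = refl
  ... | no e≢ = contradiction e e≢

  τ-recovers : NoConstants L' → RecoversOperations τ
  τ-recovers no-const f = app (n , inj₂ f) (λ i → var (Eq.subst Fin (sym e) i)) , λ A as →
    begin
      eval A (λ i → as (Eq.subst Fin (sym e) i)) (τ (n , inj₂ f))
    ≡⟨ cong (eval A (λ i → as (Eq.subst Fin (sym e) i))) (τ-on-arity n f e) ⟩
      op A f (λ j → as (Eq.subst Fin (sym e) (Eq.subst Fin e j)))
    ≡⟨ reindex-roundtrip (op A f) e as ⟩
      op A f as
    ∎
    where
    n : ℕ
    n = pred (ar L' f)
    e : ar L' f ≡ suc n
    e = arity-suc (no-const f)

corollary7p5 : (⊢ : Logic) → Σ Set λ K → Infinite K × Interpretable (BasicVκ K) (proj₁ ⊢)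
corollary7p5 (P , is-logic) =
  K , ℕ⊎-infinite (Sym (Lang P)) ,
  interpretable-by (BasicVκ K) P τ (τ-recovers (IsLogic.noConst is-logic))
    (λ A G _ → basic-filter K (A ^ τ) G)
  where open Covering (Lang P)
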